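{- There is a constant $c>0$ such that for each sufficiently large $k$ there is an infinite class $\mathbf{G}_k$ of graphs such that every $G\in\mathbf{G}_k$ satisfies $tw(G)\leq k$ and $lsimw(G)\geq c\log(|V(G)|)\cdot k$.
   Context: $tw(G)$ is the treewidth of $G$. For a linear order $\pi$ of $V(G)$, a matching $M$ of $G$ crosses $\pi$ if some prefix $\pi_0$ of $\pi$ contains exactly one endpoint of each edge of $M$; $M$ is induced if $G$ has no edge between endpoints of distinct edges of $M$. $lsimw(G)$ is the minimum, over all linear orders $\pi$ of $V(G)$, of the maximum size of an induced matching of $G$ crossing $\pi$. -}

module Defs where

open import Data.Nat using (ℕ; zero; suc; _≤_; _<_)
open import Data.Fin using (Fin; zero; suc; toℕ; inject₁; fromℕ)
open import Data.Fin.Subset using (Subset; _∈_; ∣_∣)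
open import Data.Fin.Permutation using (Permutation′; _⟨$⟩ʳ_)
open import Data.Bool using (Bool; true; false)
open import Data.Product using (Σ; ∃; _×_; proj₁; proj₂)
open import Data.Sum using (_⊎_)
open import Data.Unit using (⊤)
open import Relation.Nullary using (¬_)
open import Relation.Binary.PropositionalEquality using (_≡_; _≢_)
open import Function.Definitions using (Injective)

record Graph : Set where
  field
    n      : ℕ
    E      : Fin n → Fin n → Bool
    sym    : ∀ u v → E u v ≡ E v u
    irrefl : ∀ u → E u u ≡ false

open Graph public

∣V∣ : Graph → ℕ
∣V∣ G = n G

Adj : (G : Graph) → Fin (n G) → Fin (n G) → Set
Adj G u v = E G u v ≡ true

data WalkIn (G : Graph) (P : Fin (n G) → Set) : Fin (n G) → Fin (n G) → Set where
  here : ∀ {x} → P x → WalkIn G P x x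
  step : ∀ {x y z} → P x → Adj G x y → WalkIn G P y z → WalkIn G P x z

Connected : Graph → Set
Connected G = ∀ x y → WalkIn G (λ _ → ⊤) x y

record Cycle (G : Graph) : Set where
  field
    m     : ℕ
    len≥3 : 2 ≤ m
    f     : Fin (suc m) → Fin (n G)
    inj   : Injective _≡_ _≡_ f
    path  : ∀ (i : Fin m) → Adj G (f (inject₁ i)) (f (suc i))
    close : Adj G (f (fromℕ m)) (f zero)

IsTree : Graph → Set
IsTree T = (1 ≤ n T) × Connected T × ¬ Cycle T

record TreeDecomposition (G : Graph) (k : ℕ) : Set where
  field
    T         : Graph
    isTree    : IsTree T
    bag       : Fin (n T) → Subset (n G)
    coverV    : ∀ v → ∃ λ t → v ∈ bag t
    coverE    : ∀ u v → Adj G u v → ∃ λ t → (u ∈ bag t) × (v ∈ bag t)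
    subtree   : ∀ v t t′ → v ∈ bag t → v ∈ bag t′ → WalkIn T (λ s → v ∈ bag s) t t′
    width≤k   : ∀ t → ∣ bag t ∣ ≤ suc k

TwAtMost : Graph → ℕ → Set
TwAtMost G k = TreeDecomposition G k

record InducedMatching (G : Graph) (l : ℕ) : Set where
  field
    ends     : Fin l → Fin (n G) × Fin (n G)
    isEdge   : ∀ i → Adj G (proj₁ (ends i)) (proj₂ (ends i))
  Endpoint : Fin l → Fin (n G) → Set
  Endpoint i x = (x ≡ proj₁ (ends i)) ⊎ (x ≡ proj₂ (ends i))
  field
    disjoint : ∀ i j → i ≢ j → ∀ x y → Endpoint i x → Endpoint j y → x ≢ y
    induced  : ∀ i j → i ≢ j → ∀ x y → Endpoint i x → Endpoint j y → ¬ Adj G x y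

-- A linear order of V(G), given by σ : vertex ↦ position.
LinearOrder : Graph → Set
LinearOrder G = Permutation′ (n G)

InPrefix : (G : Graph) → LinearOrder G → ℕ → Fin (n G) → Set
InPrefix G σ p v = toℕ (σ ⟨$⟩ʳ v) < p

Crosses : (G : Graph) {l : ℕ} → InducedMatching G l → LinearOrder G → Set
Crosses G {l} M σ = Σ ℕ λ p → ∀ (i : Fin l) →
    (InPrefix G σ p (proj₁ (InducedMatching.ends M i)) × ¬ InPrefix G σ p (proj₂ (InducedMatching.ends M i)))
  ⊎ (InPrefix G σ p (proj₂ (InducedMatching.ends M i)) × ¬ InPrefix G σ p (proj₁ (InducedMatching.ends M i)))

LsimwAtLeast : Graph → ℕ → Set
LsimwAtLeast G s = ∀ (σ : LinearOrder G) →
  Σ ℕ λ l → (s ≤ l) × Σ (InducedMatching G l) λ M → Crosses G M σ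

-- The graphs are Cartesian products T □ P of a tree T with a path P on 2R vertices.  T₀ is a path on
-- 2B + 1 nodes and T_{h+1} joins three copies of T_h through a root.  Taking as bag of a node the vertices
-- of its column and of its parent's column gives width < 4R ≤ k.
-- For the lower bound fix a linear order and argue by induction on h: either some prefix is crossed by an
-- induced matching with B edges, or some prefix is crossed by one with hR edges while one column lies
-- inside and another column outside it.  In T₀, if no column lies outside the prefix ending at the
-- smallest column maximum, every column has vertices on both sides of it, and the even columns give B
-- crossing edges.  In T_{h+1}, cut at the middle of the three thresholds of the copies: a walk from the
-- inside column of the earliest copy to the outside column of the latest one, avoiding the middle copy,
-- crosses the prefix in each even layer, adding R edges to the matching of the middle copy.
-- With h = N + k, R ≈ k/4 and B = hR the graph has at most 2^{9h} vertices and lsimw ≥ hR.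
module Submission where

open import Defs hiding (sym)
import Data.Nat
open import Data.Nat using (ℕ; zero; suc; _+_; _*_; _^_; _≤_; _<_; z≤n; s≤s; _≤?_; _<?_)
open import Data.Nat.Properties hiding (_≟_)
open import Data.Nat.DivMod using (_/_; _%_; m/n*n≤m; m≥n⇒m/n>0; m≡m%n+[m/n]*n; m%n<n)
open import Data.Nat.Tactic.RingSolver using (solve-∀)
open import Data.Bool using (true; false)
open import Data.Fin as Fin
  using (Fin; zero; suc; toℕ; inject₁; fromℕ; fromℕ<; punchIn; punchOut; _↑ʳ_; splitAt; join; combine)
open import Data.Fin.Patterns using (0F; 1F; 2F)
open import Data.Fin.Properties
  using (toℕ-inject₁; toℕ-injective; toℕ<n; toℕ-fromℕ<; punchOut-injective; punchInᵢ≢i; all?; any?; ¬∀⟶∃¬;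
         join-splitAt; combine-injective; 1↔⊤; +↔⊎; *↔×)
  renaming (suc-injective to fsuc-injective)
open import Data.Fin.Subset using (Subset; _∈_; ∣_∣)
open import Data.Fin.Permutation using (_⟨$⟩ʳ_; _⟨$⟩ˡ_; inverseˡ)
open import Data.Vec using ([]; _∷_; tabulate; here; there)
open import Data.Vec.Properties using (lookup∘tabulate; []=⇒lookup; lookup⇒[]=)
open import Data.Maybe using (Maybe; just; nothing)
open import Data.Maybe.Properties using (just-injective) renaming (≡-dec to ≡-dec-Maybe)
open import Data.Product using (Σ; ∃; ∃₂; _×_; _,_; proj₁; proj₂)
open import Data.Product.Function.NonDependent.Propositional using (_×-↔_)
open import Data.Sum using (_⊎_; inj₁; inj₂; [_,_])
open import Data.Sum.Function.Propositional using (_⊎-↔_)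
open import Data.Unit using (⊤; tt)
open import Data.Empty using (⊥-elim)
open import Function using (id)
open import Function.Bundles using (_↔_; Inverse; mk↔ₛ′; mk⇔)
open import Function.Definitions using (Injective)
open import Function.Properties.Inverse using (↔-refl; ↔-sym; ↔-trans; ↔⇒↣)
open import Relation.Nullary using (¬_; Dec; yes; no; does; proof)
open import Relation.Nullary.Decidable using (via-injection; dec-true; dec-false; does-⇔; _×-dec_; _⊎-dec_)
open import Relation.Nullary.Reflects using (Reflects; invert)
open import Relation.Binary.PropositionalEquality
  using (_≡_; _≢_; refl; sym; trans; cong; cong₂; subst; subst₂; module ≡-Reasoning)

data Walk {A : Set} (_~_ : A → A → Set) (P : A → Set) : A → A → Set where
  here : ∀ {x} → P x → Walk _~_ P x x
  step : ∀ {x y z} → P x → x ~ y → Walk _~_ P y z → Walk _~_ P x z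

module _ {A : Set} {_~_ : A → A → Set} {P : A → Set} where

  _++ʷ_ : ∀ {x y z} → Walk _~_ P x y → Walk _~_ P y z → Walk _~_ P x z
  here _ ++ʷ w′ = w′
  step p e w ++ʷ w′ = step p e (w ++ʷ w′)

  walk-start : ∀ {x y} → Walk _~_ P x y → P x
  walk-start (here p) = p
  walk-start (step p _ _) = p

  reverseʷ : (∀ {x y} → x ~ y → y ~ x) → ∀ {x y} → Walk _~_ P x y → Walk _~_ P y x
  reverseʷ ~-sym (here p) = here p
  reverseʷ ~-sym (step p e w) = reverseʷ ~-sym w ++ʷ step (walk-start w) (~-sym e) (here p)

  leaving-edge : (D : A → Set) → (∀ x → Dec (D x)) → ∀ {x y} → Walk _~_ P x y → D x → ¬ D y →
                 ∃₂ λ u v → u ~ v × P u × P v × D u × ¬ D v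
  leaving-edge D D? (here _) dx ¬dy = ⊥-elim (¬dy dx)
  leaving-edge D D? (step {y = y} p e w) dx ¬dz with D? y
  ... | no ¬dy = _ , _ , e , p , walk-start w , dx , ¬dy
  ... | yes dy = leaving-edge D D? w dy ¬dz

mapʷ : ∀ {A B : Set} {_~_ : A → A → Set} {P : A → Set} {_≈_ : B → B → Set} {Q : B → Set}
       (g : A → B) → (∀ {x y} → x ~ y → g x ≈ g y) → (∀ x → Q (g x)) →
       ∀ {x y} → Walk _~_ P x y → Walk _≈_ Q (g x) (g y)
mapʷ g g-edge g-Q (here _) = here (g-Q _)
mapʷ g g-edge g-Q (step _ e w) = step (g-Q _) (g-edge e) (mapʷ g g-edge g-Q w)

walk-to-zero : ∀ {n} (_~_ : Fin (suc n) → Fin (suc n) → Set) → (∀ i → suc i ~ inject₁ i) →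
               ∀ j → Walk _~_ (λ _ → ⊤) j zero
walk-to-zero _~_ down zero = here tt
walk-to-zero {suc n} _~_ down (suc i) =
  step tt (down i) (mapʷ inject₁ id (λ _ → tt)
    (walk-to-zero (λ a b → inject₁ a ~ inject₁ b) (λ i → down (inject₁ i)) i))

argmax : ∀ {n} (f : Fin (suc n) → ℕ) → Σ (Fin (suc n)) λ j → ∀ i → f i ≤ f j
argmax {zero} f = zero , λ { zero → ≤-refl }
argmax {suc n} f with argmax (λ i → f (suc i))
... | j , max-j with f zero ≤? f (suc j)
... | yes f0≤ = suc j , λ { zero → f0≤ ; (suc i) → max-j i }
... | no f0≰ = zero , λ { zero → ≤-refl ; (suc i) → ≤-trans (max-j i) (<⇒≤ (≰⇒> f0≰)) }

argmin : ∀ {n} (f : Fin (suc n) → ℕ) → Σ (Fin (suc n)) λ j → ∀ i → f j ≤ f i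
argmin {zero} f = zero , λ { zero → ≤-refl }
argmin {suc n} f with argmin (λ i → f (suc i))
... | j , min-j with f zero ≤? f (suc j)
... | yes f0≤ = zero , λ { zero → ≤-refl ; (suc i) → ≤-trans f0≤ (min-j i) }
... | no f0≰ = suc j , λ { zero → <⇒≤ (≰⇒> f0≰) ; (suc i) → min-j i }

median : (t : Fin 3 → ℕ) → Σ (Fin 3) λ b → Σ (Fin 3) λ a → Σ (Fin 3) λ c →
         a ≢ b × c ≢ b × t a ≤ t b × t b ≤ t c
median t with ≤-total (t 0F) (t 1F) | ≤-total (t 1F) (t 2F) | ≤-total (t 0F) (t 2F)
... | inj₁ p | inj₁ q | _      = 1F , 0F , 2F , (λ ()) , (λ ()) , p , q
... | inj₁ p | inj₂ q | inj₁ r = 2F , 0F , 1F , (λ ()) , (λ ()) , r , q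
... | inj₁ p | inj₂ q | inj₂ r = 0F , 2F , 1F , (λ ()) , (λ ()) , r , p
... | inj₂ p | inj₂ q | _      = 1F , 2F , 0F , (λ ()) , (λ ()) , q , p
... | inj₂ p | inj₁ q | inj₁ r = 0F , 1F , 2F , (λ ()) , (λ ()) , p , r
... | inj₂ p | inj₁ q | inj₂ r = 2F , 1F , 0F , (λ ()) , (λ ()) , q , r

last-or-inject₁ : ∀ {m} (i : Fin (suc m)) → i ≡ fromℕ m ⊎ ∃ λ j → i ≡ inject₁ j
last-or-inject₁ {zero} zero = inj₁ refl
last-or-inject₁ {suc m} zero = inj₂ (zero , refl)
last-or-inject₁ {suc m} (suc i) with last-or-inject₁ i
... | inj₁ i≡last = inj₁ (cong suc i≡last)
... | inj₂ (j , i≡j) = inj₂ (suc j , cong suc i≡j)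

cycle-neighbours : ∀ m → 2 ≤ m → (_~_ : Fin (suc m) → Fin (suc m) → Set) →
                   (∀ (i : Fin m) → inject₁ i ~ suc i) → fromℕ m ~ zero →
                   ∀ i → ∃₂ λ j k → j ≢ k × (i ~ j ⊎ j ~ i) × (i ~ k ⊎ k ~ i)
cycle-neighbours (suc zero) (s≤s ())
cycle-neighbours (suc (suc m)) _ _~_ next close i with last-or-inject₁ i
... | inj₁ refl = zero , inject₁ (fromℕ (suc m)) , (λ ()) , inj₁ close , inj₂ (next (fromℕ (suc m)))
... | inj₂ (zero , refl) = suc zero , fromℕ (suc (suc m)) , (λ ()) , inj₁ (next zero) , inj₂ close
... | inj₂ (suc j , refl) = suc (suc j) , inject₁ (inject₁ j) , 2+j≢j , inj₁ (next (suc j)) , inj₂ (next (inject₁ j))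
  where
    2+j≢j : suc (suc j) ≢ inject₁ (inject₁ j)
    2+j≢j e = m≢1+n+m (toℕ j) {1} (sym (trans (cong toℕ e) (trans (toℕ-inject₁ (inject₁ j)) (toℕ-inject₁ j))))

∣p∣≤-by-injection : ∀ {n m} (p : Subset n) (g : ∀ i → i ∈ p → Fin m) →
                    (∀ i j i∈p j∈p → g i i∈p ≡ g j j∈p → i ≡ j) → ∣ p ∣ ≤ m
∣p∣≤-by-injection [] g g-inj = z≤n
∣p∣≤-by-injection (false ∷ p) g g-inj = ∣p∣≤-by-injection p (λ i i∈p → g (suc i) (there i∈p))
  (λ i j i∈p j∈p e → fsuc-injective (g-inj (suc i) (suc j) (there i∈p) (there j∈p) e))
∣p∣≤-by-injection {m = zero} (true ∷ p) g g-inj with g zero here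
... | ()
∣p∣≤-by-injection {m = suc m} (true ∷ p) g g-inj =
  s≤s (∣p∣≤-by-injection p (λ i i∈p → punchOut (g0≢ i i∈p)) (λ i j i∈p j∈p e →
    fsuc-injective (g-inj (suc i) (suc j) (there i∈p) (there j∈p) (punchOut-injective (g0≢ i i∈p) (g0≢ j j∈p) e))))
  where
    g0≢ : ∀ i i∈p → g zero here ≢ g (suc i) (there i∈p)
    g0≢ i i∈p e with g-inj zero (suc i) here (there i∈p) e
    ... | ()

evens-apart : ∀ {n} {r r′ : Fin n} → r ≢ r′ → 2 * toℕ r ≢ 2 * toℕ r′ × 2 * toℕ r′ ≢ suc (2 * toℕ r)
evens-apart {r = r} {r′} r≢r′ =
  (λ e → r≢r′ (toℕ-injective (*-cancelˡ-≡ (toℕ r) (toℕ r′) 2 e))) , even≢odd (toℕ r′) (toℕ r)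

subset : ∀ {n} {P : Fin n → Set} → (∀ i → Dec (P i)) → Subset n
subset P? = tabulate λ i → does (P? i)

∈-subset⁺ : ∀ {n} {P : Fin n → Set} (P? : ∀ i → Dec (P i)) {i} → P i → i ∈ subset P?
∈-subset⁺ P? {i} p = lookup⇒[]= i _ (trans (lookup∘tabulate _ i) (dec-true (P? i) p))

∈-subset⁻ : ∀ {n} {P : Fin n → Set} (P? : ∀ i → Dec (P i)) {i} → i ∈ subset P? → P i
∈-subset⁻ P? {i} i∈ = invert (subst (Reflects _) (trans (sym (lookup∘tabulate _ i)) ([]=⇒lookup i∈)) (proof (P? i)))

-- The graphs

module Tree (B : ℕ) where

  -- Level 0 is the path  path-node 0 — … — path-node (2B),  rooted at path-node 0.  Level h+1 is a root with
  -- three children  hub a,  below each of which hangs a copy  copy a _  of level h.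
  data Node : ℕ → Set where
    path-node : Fin (suc (2 * B)) → Node 0
    root : ∀ {h} → Node (suc h)
    hub  : ∀ {h} → Fin 3 → Node (suc h)
    copy : ∀ {h} → Fin 3 → Node h → Node (suc h)

  rootOf : ∀ h → Node h
  rootOf zero = path-node zero
  rootOf (suc h) = root

  parent-in-copy : ∀ {h} → Fin 3 → Maybe (Node h) → Maybe (Node (suc h))
  parent-in-copy a nothing = just (hub a)
  parent-in-copy a (just y) = just (copy a y)

  parent : ∀ {h} → Node h → Maybe (Node h)
  parent (path-node zero) = nothing
  parent (path-node (suc i)) = just (path-node (inject₁ i))
  parent root = nothing
  parent (hub a) = just root
  parent (copy a x) = parent-in-copy a (parent x)

  TreeEdge : ∀ {h} → Node h → Node h → Set
  TreeEdge x y = parent y ≡ just x ⊎ parent x ≡ just y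

  TreeEdge-sym : ∀ {h} {x y : Node h} → TreeEdge x y → TreeEdge y x
  TreeEdge-sym (inj₁ e) = inj₂ e
  TreeEdge-sym (inj₂ e) = inj₁ e

  parent-in-copy-just : ∀ {h} a {m : Maybe (Node h)} {x} → m ≡ just x → parent-in-copy a m ≡ just (copy a x)
  parent-in-copy-just a refl = refl

  parent-in-copy-copy : ∀ {h} a b (m : Maybe (Node h)) x → parent-in-copy a m ≡ just (copy b x) → m ≡ just x × a ≡ b
  parent-in-copy-copy a b (just y) x refl = refl , refl

  parent-in-copy-hub : ∀ {h} a b (m : Maybe (Node h)) → parent-in-copy a m ≡ just (hub b) → a ≡ b
  parent-in-copy-hub a b nothing refl = refl

  parent-in-copy≢root : ∀ {h} a (m : Maybe (Node h)) → parent-in-copy a m ≢ just root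
  parent-in-copy≢root a nothing ()
  parent-in-copy≢root a (just y) ()

  copy-edge : ∀ {h} a {x y : Node h} → TreeEdge x y → TreeEdge (copy a x) (copy a y)
  copy-edge a (inj₁ e) = inj₁ (parent-in-copy-just a e)
  copy-edge a (inj₂ e) = inj₂ (parent-in-copy-just a e)

  copy-edge⁻ : ∀ {h} a {x y : Node h} → TreeEdge (copy a x) (copy a y) → TreeEdge x y
  copy-edge⁻ a {x} {y} (inj₁ e) = inj₁ (proj₁ (parent-in-copy-copy a a (parent y) x e))
  copy-edge⁻ a {x} {y} (inj₂ e) = inj₂ (proj₁ (parent-in-copy-copy a a (parent x) y e))

  hub-edge : ∀ h a → TreeEdge (copy a (rootOf h)) (hub a)
  hub-edge zero a = inj₂ refl
  hub-edge (suc h) a = inj₂ refl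

  -- Nodes outside the copy b and not adjacent to it.
  Avoids : ∀ {h} → Fin 3 → Node (suc h) → Set
  Avoids b root = ⊤
  Avoids b (hub a) = a ≢ b
  Avoids b (copy a _) = a ≢ b

  avoids⇒≢copy : ∀ {h} b (u : Node (suc h)) y → Avoids b u → u ≢ copy b y
  avoids⇒≢copy b (copy a x) y a≢b e = a≢b (cong copy-index e)
    where
      copy-index : Node (suc _) → Fin 3
      copy-index (copy a _) = a
      copy-index _ = b

  avoids⇒¬edge-copy : ∀ {h} b (u : Node (suc h)) y → Avoids b u → ¬ TreeEdge u (copy b y)
  avoids⇒¬edge-copy b root y _ (inj₁ e) = parent-in-copy≢root b (parent y) e
  avoids⇒¬edge-copy b (hub a) y a≢b (inj₁ e) = a≢b (sym (parent-in-copy-hub b a (parent y) e))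
  avoids⇒¬edge-copy b (copy a x) y a≢b (inj₁ e) = a≢b (sym (proj₂ (parent-in-copy-copy b a (parent y) x e)))
  avoids⇒¬edge-copy b (copy a x) y a≢b (inj₂ e) = a≢b (proj₂ (parent-in-copy-copy a b (parent x) y e))

  walk-to-root : ∀ h (x : Node h) → Walk TreeEdge (λ _ → ⊤) x (rootOf h)
  walk-to-root zero (path-node c) =
    mapʷ path-node id (λ _ → tt) (walk-to-zero (λ c c′ → TreeEdge (path-node c) (path-node c′)) (λ _ → inj₂ refl) c)
  walk-to-root (suc h) root = here tt
  walk-to-root (suc h) (hub a) = step tt (inj₂ refl) (here tt)
  walk-to-root (suc h) (copy a x) =
    mapʷ (copy a) (copy-edge a) (λ _ → tt) (walk-to-root h x) ++ʷ step tt (hub-edge h a) (step tt (inj₂ refl) (here tt))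

  walk-between-copies : ∀ {h a b c} → a ≢ b → c ≢ b → ∀ x y → Walk TreeEdge (Avoids b) (copy {h} a x) (copy c y)
  walk-between-copies {h} {a} {b} {c} a≢b c≢b x y =
    mapʷ (copy a) (copy-edge a) (λ _ → a≢b) (walk-to-root h x)
      ++ʷ step a≢b (hub-edge h a) (step a≢b (inj₂ refl) (step tt (inj₁ refl) (step c≢b (TreeEdge-sym (hub-edge h c))
      (mapʷ (copy c) (copy-edge c) (λ _ → c≢b) (reverseʷ TreeEdge-sym (walk-to-root h y))))))

  depth : ∀ {h} → Node h → ℕ
  depth (path-node c) = toℕ c
  depth root = 0
  depth (hub _) = 1
  depth (copy _ x) = 2 + depth x

  depth-parent : ∀ {h} (y : Node h) {x} → parent y ≡ just x → depth y ≡ suc (depth x)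
  depth-parent (path-node (suc i)) refl = cong suc (sym (toℕ-inject₁ i))
  depth-parent (hub _) refl = refl
  depth-parent (copy a y) {x} e with parent y in parent-y
  depth-parent (copy a y) refl | nothing = cong (2 +_) (depth-root y parent-y)
    where
      depth-root : ∀ {h} (y : Node h) → parent y ≡ nothing → depth y ≡ 0
      depth-root (path-node zero) _ = refl
      depth-root root _ = refl
      depth-root (copy a y) e with parent y
      depth-root (copy a y) () | nothing
      depth-root (copy a y) () | just _
  depth-parent (copy a y) refl | just z = cong (2 +_) (depth-parent y parent-y)

  TreeEdge-irrefl : ∀ {h} (x : Node h) → ¬ TreeEdge x x
  TreeEdge-irrefl x (inj₁ e) = 1+n≢n (sym (depth-parent x e))
  TreeEdge-irrefl x (inj₂ e) = 1+n≢n (sym (depth-parent x e))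

  node-count : ℕ → ℕ
  node-count zero = suc (2 * B)
  node-count (suc h) = 1 + (3 + 3 * node-count h)

  node↔fin : ∀ h → Node h ↔ Fin (node-count h)
  node↔fin zero = mk↔ₛ′ (λ { (path-node c) → c }) path-node (λ _ → refl) (λ { (path-node c) → refl })
  node↔fin (suc h) = ↔-trans unfold (↔-trans (↔-sym 1↔⊤ ⊎-↔ (↔-refl ⊎-↔ (↔-refl ×-↔ node↔fin h))) (↔-sym fin-unfold))
    where
      unfold : Node (suc h) ↔ (⊤ ⊎ (Fin 3 ⊎ Fin 3 × Node h))
      unfold = mk↔ₛ′ (λ { root → inj₁ tt ; (hub a) → inj₂ (inj₁ a) ; (copy a x) → inj₂ (inj₂ (a , x)) })
                     (λ { (inj₁ _) → root ; (inj₂ (inj₁ a)) → hub a ; (inj₂ (inj₂ (a , x))) → copy a x })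
                     (λ { (inj₁ _) → refl ; (inj₂ (inj₁ a)) → refl ; (inj₂ (inj₂ (a , x))) → refl })
                     (λ { root → refl ; (hub a) → refl ; (copy a x) → refl })
      fin-unfold : Fin (node-count (suc h)) ↔ (Fin 1 ⊎ (Fin 3 ⊎ Fin 3 × Fin (node-count h)))
      fin-unfold = ↔-trans +↔⊎ (↔-refl ⊎-↔ (↔-trans +↔⊎ (↔-refl ⊎-↔ *↔×)))

  _≟_ : ∀ {h} → (x y : Node h) → Dec (x ≡ y)
  _≟_ {h} = via-injection (↔⇒↣ (node↔fin h)) Fin._≟_

  TreeEdge? : ∀ {h} (x y : Node h) → Dec (TreeEdge x y)
  TreeEdge? x y = ≡-dec-Maybe _≟_ (parent y) (just x) ⊎-dec ≡-dec-Maybe _≟_ (parent x) (just y)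

  node-count-closed : ∀ h → node-count h + 2 ≡ 3 ^ h * (2 * B + 3)
  node-count-closed zero = base (2 * B)
    where
      base : ∀ x → suc x + 2 ≡ 1 * (x + 3)
      base = solve-∀
  node-count-closed (suc h) = begin
    1 + (3 + 3 * node-count h) + 2 ≡⟨ unfold (node-count h) ⟩
    3 * (node-count h + 2)         ≡⟨ cong (3 *_) (node-count-closed h) ⟩
    3 * (3 ^ h * (2 * B + 3))      ≡⟨ *-assoc 3 (3 ^ h) (2 * B + 3) ⟨
    3 ^ suc h * (2 * B + 3)        ∎
    where
      open ≡-Reasoning
      unfold : ∀ x → 1 + (3 + 3 * x) + 2 ≡ 3 * (x + 2)
      unfold = solve-∀

  path-length<node-count : ∀ h → 2 * B < node-count h
  path-length<node-count zero = ≤-refl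
  path-length<node-count (suc h) =
    ≤-trans (path-length<node-count h) (≤-trans (m≤n*m (node-count h) 3) (m≤n+m (3 * node-count h) 4))

module Grid (B R′ : ℕ) where

  open Tree B public

  R : ℕ
  R = suc R′

  L : ℕ
  L = 2 * R

  Vertex : ℕ → Set
  Vertex h = Node h × Fin L

  LayerEdge : Fin L → Fin L → Set
  LayerEdge i j = toℕ j ≡ suc (toℕ i) ⊎ toℕ i ≡ suc (toℕ j)

  GridEdge : ∀ {h} → Vertex h → Vertex h → Set
  GridEdge (x , i) (y , j) = (i ≡ j × TreeEdge x y) ⊎ (x ≡ y × LayerEdge i j)

  LayerEdge-sym : ∀ {i j} → LayerEdge i j → LayerEdge j i
  LayerEdge-sym (inj₁ e) = inj₂ e
  LayerEdge-sym (inj₂ e) = inj₁ e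

  GridEdge-sym : ∀ {h} {u v : Vertex h} → GridEdge u v → GridEdge v u
  GridEdge-sym (inj₁ (i≡j , e)) = inj₁ (sym i≡j , TreeEdge-sym e)
  GridEdge-sym (inj₂ (x≡y , e)) = inj₂ (sym x≡y , LayerEdge-sym e)

  Far : ∀ {h} → Vertex h → Vertex h → Set
  Far u v = u ≢ v × ¬ GridEdge u v

  Far-sym : ∀ {h} {u v : Vertex h} → Far u v → Far v u
  Far-sym (u≢v , ¬uv) = (λ e → u≢v (sym e)) , (λ e → ¬uv (GridEdge-sym e))

  Edge : ℕ → Set
  Edge h = Vertex h × Vertex h

  Separated : ∀ {h} → Edge h → Edge h → Set
  Separated (a , b) (c , d) = Far a c × Far a d × Far b c × Far b d

  Separated-sym : ∀ {h} {e f : Edge h} → Separated e f → Separated f e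
  Separated-sym (ac , ad , bc , bd) = Far-sym ac , Far-sym bc , Far-sym ad , Far-sym bd

  -- pos v is the position of v in a linear order; t is the length of a prefix.
  CrossesAt : ∀ {h} → (Vertex h → ℕ) → ℕ → Edge h → Set
  CrossesAt pos t (u , v) = GridEdge u v × pos u < t × t ≤ pos v

  record CrossingMatching {h} (pos : Vertex h → ℕ) (t l : ℕ) : Set where
    field
      edge      : Fin l → Edge h
      crosses   : ∀ i → CrossesAt pos t (edge i)
      separated : ∀ i j → i ≢ j → Separated (edge i) (edge j)

  BeforeAt AfterAt : ∀ {h} → (Vertex h → ℕ) → ℕ → Node h → Set
  BeforeAt pos t x = ∀ j → pos (x , j) < t
  AfterAt pos t x = ∀ j → t ≤ pos (x , j)

  record Straddles h (m : ℕ) (pos : Vertex h → ℕ) : Set where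
    field
      threshold  : ℕ
      size       : ℕ
      m≤size     : m ≤ size
      matching   : CrossingMatching pos threshold size
      early      : Node h
      early-before : BeforeAt pos threshold early
      late       : Node h
      late-after : AfterAt pos threshold late

  Outcome : ∀ h → ℕ → (Vertex h → ℕ) → Set
  Outcome h m pos = (Σ ℕ λ t → Σ ℕ λ l → B ≤ l × CrossingMatching pos t l) ⊎ Straddles h m pos

  Claim : ℕ → ℕ → Set
  Claim h m = ∀ (pos : Vertex h → ℕ) → Injective _≡_ _≡_ pos → Outcome h m pos

  empty-matching : ∀ {h} (pos : Vertex h → ℕ) t → CrossingMatching pos t 0
  empty-matching pos t = record { edge = λ () ; crosses = λ () ; separated = λ () }

  append-matching : ∀ {h} {pos : Vertex h → ℕ} {t l₁ l₂}
                    (M₁ : CrossingMatching pos t l₁) (M₂ : CrossingMatching pos t l₂) →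
                    (∀ i j → Separated (CrossingMatching.edge M₁ i) (CrossingMatching.edge M₂ j)) →
                    CrossingMatching pos t (l₁ + l₂)
  append-matching {h} {pos} {t} {l₁} {l₂} M₁ M₂ sep₁₂ = record { edge = e ; crosses = cr ; separated = sep }
    where
      open CrossingMatching M₁ renaming (edge to e₁; crosses to cr₁; separated to sep₁)
      open CrossingMatching M₂ renaming (edge to e₂; crosses to cr₂; separated to sep₂)
      e : Fin (l₁ + l₂) → Edge h
      e i = [ e₁ , e₂ ] (splitAt l₁ i)
      cr : ∀ i → CrossesAt pos t (e i)
      cr i with splitAt l₁ i
      ... | inj₁ i₁ = cr₁ i₁
      ... | inj₂ i₂ = cr₂ i₂
      split-injective : ∀ {i j} → splitAt l₁ i ≡ splitAt l₁ j → i ≡ j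
      split-injective {i} {j} s =
        trans (sym (join-splitAt l₁ l₂ i)) (trans (cong (join l₁ l₂) s) (join-splitAt l₁ l₂ j))
      sep : ∀ i j → i ≢ j → Separated (e i) (e j)
      sep i j i≢j with splitAt l₁ i in si | splitAt l₁ j in sj
      ... | inj₁ i₁ | inj₁ j₁ = sep₁ i₁ j₁ (λ { refl → i≢j (split-injective (trans si (sym sj))) })
      ... | inj₁ i₁ | inj₂ j₂ = sep₁₂ i₁ j₂
      ... | inj₂ i₂ | inj₁ j₁ = Separated-sym (sep₁₂ j₁ i₂)
      ... | inj₂ i₂ | inj₂ j₂ = sep₂ i₂ j₂ (λ { refl → i≢j (split-injective (trans si (sym sj))) })

  layer-walk : ∀ i j → Walk LayerEdge (λ _ → ⊤) i j
  layer-walk i j = to-bottom i ++ʷ reverseʷ LayerEdge-sym (to-bottom j)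
    where
      to-bottom : ∀ k → Walk LayerEdge (λ _ → ⊤) k zero
      to-bottom = walk-to-zero LayerEdge (λ k → inj₂ (cong suc (sym (toℕ-inject₁ k))))

  another-layer : ∀ j → ∃ λ j′ → j′ ≢ j
  another-layer j = punchIn j (R′ ↑ʳ zero {R′ + 0}) , punchInᵢ≢i j _

  far-columns : ∀ {h} {x y : Node h} i j → x ≢ y → ¬ TreeEdge x y → Far (x , i) (y , j)
  far-columns i j x≢y ¬xy = (λ e → x≢y (cong proj₁ e)) , λ { (inj₁ (_ , e)) → ¬xy e ; (inj₂ (e , _)) → x≢y e }

  far-layers : ∀ {h} (x y : Node h) {i j} → toℕ i ≢ toℕ j → toℕ j ≢ suc (toℕ i) → toℕ i ≢ suc (toℕ j) →
               Far (x , i) (y , j)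
  far-layers x y i≢j j≢1+i i≢1+j = (λ e → i≢j (cong (λ v → toℕ (proj₂ v)) e)) ,
    λ { (inj₁ (e , _)) → i≢j (cong toℕ e) ; (inj₂ (_ , inj₁ e)) → j≢1+i e ; (inj₂ (_ , inj₂ e)) → i≢1+j e }

  spaced-layer : Fin R → Fin L
  spaced-layer r = fromℕ< (*-monoʳ-< 2 (toℕ<n r))

  spaced-column : Fin B → Fin (suc (2 * B))
  spaced-column r = fromℕ< (m<n⇒m<1+n (*-monoʳ-< 2 (toℕ<n r)))

  spaced-layers-far : ∀ {h} {r r′} → r ≢ r′ → (x y : Node h) → Far (x , spaced-layer r) (y , spaced-layer r′)
  spaced-layers-far {r = r} {r′} r≢r′ x y = far-layers x y
    (λ e → proj₁ (evens-apart r≢r′) (trans (sym ℓ≡) (trans e ℓ′≡)))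
    (λ e → proj₂ (evens-apart r≢r′) (trans (sym ℓ′≡) (trans e (cong suc ℓ≡))))
    (λ e → proj₂ (evens-apart (λ x → r≢r′ (sym x))) (trans (sym ℓ≡) (trans e (cong suc ℓ′≡))))
    where
      ℓ≡ : toℕ (spaced-layer r) ≡ 2 * toℕ r
      ℓ≡ = toℕ-fromℕ< _
      ℓ′≡ : toℕ (spaced-layer r′) ≡ 2 * toℕ r′
      ℓ′≡ = toℕ-fromℕ< _

  spaced-columns-far : ∀ {r r′} → r ≢ r′ → ∀ i j →
                       Far (path-node (spaced-column r) , i) (path-node (spaced-column r′) , j)
  spaced-columns-far {r} {r′} r≢r′ i j = far-columns i j col≢ ¬edge
    where
      c c′ : Fin (suc (2 * B))
      c = spaced-column r
      c′ = spaced-column r′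
      c≡ : toℕ c ≡ 2 * toℕ r
      c≡ = toℕ-fromℕ< _
      c′≡ : toℕ c′ ≡ 2 * toℕ r′
      c′≡ = toℕ-fromℕ< _
      col≢ : path-node c ≢ path-node c′
      col≢ e = proj₁ (evens-apart r≢r′) (trans (sym c≡) (trans (cong depth e) c′≡))
      ¬edge : ¬ TreeEdge (path-node c) (path-node c′)
      ¬edge (inj₁ e) = proj₂ (evens-apart r≢r′)
        (trans (sym c′≡) (trans (depth-parent (path-node c′) e) (cong suc c≡)))
      ¬edge (inj₂ e) = proj₂ (evens-apart (λ x → r≢r′ (sym x)))
        (trans (sym c≡) (trans (depth-parent (path-node c) e) (cong suc c′≡)))

  -- The induction on the height of the tree

  module PathLevel (pos : Vertex 0 → ℕ) (pos-inj : Injective _≡_ _≡_ pos) where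

    column-max : Node 0 → ℕ
    column-max x = pos (x , proj₁ (argmax λ j → pos (x , j)))

    ≤column-max : ∀ x j → pos (x , j) ≤ column-max x
    ≤column-max x = proj₂ (argmax λ j → pos (x , j))

    c₀ : Node 0
    c₀ = path-node (proj₁ (argmin λ c → column-max (path-node c)))

    T₀ : ℕ
    T₀ = column-max c₀

    reaches-T₀ : ∀ c → ∃ λ j → T₀ ≤ pos (path-node c , j)
    reaches-T₀ c = proj₁ (argmax λ j → pos (path-node c , j)) , proj₂ (argmin λ c → column-max (path-node c)) c

    below-T₀ : ∀ c → ¬ AfterAt pos (suc T₀) (path-node c) → ∃ λ j → pos (path-node c , j) < T₀
    below-T₀ c ¬after with ¬∀⟶∃¬ L _ (λ j → suc T₀ ≤? pos (path-node c , j)) ¬after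
    ... | j , ¬after-j with pos (path-node c , j) <? T₀
    ... | yes below = j , below
    ... | no ¬below = j′ , ≤∧≢⇒< j′≤T₀ j′≢T₀
      where
        at-T₀ : pos (path-node c , j) ≡ T₀
        at-T₀ = ≤-antisym (≤-pred (≰⇒> ¬after-j)) (≮⇒≥ ¬below)
        j′ : Fin L
        j′ = proj₁ (another-layer j)
        -- Only the vertex of c₀ realising T₀ sits at T₀, and c₀ has another layer.
        j′≤T₀ : pos (path-node c , j′) ≤ T₀
        j′≤T₀ = subst (λ x → pos (x , j′) ≤ T₀) (sym (cong proj₁ (pos-inj at-T₀))) (≤column-max c₀ j′)
        j′≢T₀ : pos (path-node c , j′) ≢ T₀
        j′≢T₀ e = proj₂ (another-layer j) (cong proj₂ (pos-inj (trans e (sym at-T₀))))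

    crossing-in-column : ∀ c → ¬ AfterAt pos (suc T₀) (path-node c) →
                         ∃₂ λ i j → LayerEdge i j × pos (path-node c , i) < T₀ × T₀ ≤ pos (path-node c , j)
    crossing-in-column c ¬after
      with leaving-edge (λ j → pos (path-node c , j) < T₀) (λ j → pos (path-node c , j) <? T₀)
             (layer-walk (proj₁ (below-T₀ c ¬after)) (proj₁ (reaches-T₀ c)))
             (proj₂ (below-T₀ c ¬after)) (≤⇒≯ (proj₂ (reaches-T₀ c)))
    ... | i , j , e , _ , _ , below , ¬below = i , j , e , below , ≮⇒≥ ¬below

    matching-in-spaced-columns : (∀ c → ¬ AfterAt pos (suc T₀) (path-node c)) → CrossingMatching pos T₀ B
    matching-in-spaced-columns ¬after = record { edge = edge ; crosses = crosses ; separated = separated }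
      where
        column : Fin B → Node 0
        column r = path-node (spaced-column r)
        crossing : ∀ r → ∃₂ λ i j → LayerEdge i j × pos (column r , i) < T₀ × T₀ ≤ pos (column r , j)
        crossing r = crossing-in-column (spaced-column r) (¬after (spaced-column r))
        edge : Fin B → Edge 0
        edge r = (column r , proj₁ (crossing r)) , (column r , proj₁ (proj₂ (crossing r)))
        crosses : ∀ r → CrossesAt pos T₀ (edge r)
        crosses r = let (_ , _ , e , below , above) = crossing r in inj₂ (refl , e) , below , above
        separated : ∀ r r′ → r ≢ r′ → Separated (edge r) (edge r′)
        separated r r′ r≢r′ = far , far , far , far
          where
            far : ∀ {i j} → Far (column r , i) (column r′ , j)
            far = spaced-columns-far r≢r′ _ _

    outcome : Outcome 0 0 pos
    outcome with any? (λ c → all? (λ j → suc T₀ ≤? pos (path-node c , j)))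
    ... | yes (c , after) = inj₂ (record
      { threshold = suc T₀ ; size = 0 ; m≤size = z≤n ; matching = empty-matching pos (suc T₀)
      ; early = c₀ ; early-before = λ j → s≤s (≤column-max c₀ j) ; late = path-node c ; late-after = after })
    ... | no ¬after = inj₁ (T₀ , B , ≤-refl , matching-in-spaced-columns λ c after → ¬after (c , after))

  claim-path : Claim 0 0
  claim-path pos pos-inj = PathLevel.outcome pos pos-inj

  in-copy : ∀ {h} → Fin 3 → Vertex h → Vertex (suc h)
  in-copy a (x , j) = copy a x , j

  in-copy-injective : ∀ {h} a {u v : Vertex h} → in-copy a u ≡ in-copy a v → u ≡ v
  in-copy-injective a {_ , _} {_ , _} refl = refl

  in-copy-edge : ∀ {h} a {u v : Vertex h} → GridEdge u v → GridEdge (in-copy a u) (in-copy a v)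
  in-copy-edge a (inj₁ (i≡j , e)) = inj₁ (i≡j , copy-edge a e)
  in-copy-edge a (inj₂ (x≡y , e)) = inj₂ (cong (copy a) x≡y , e)

  in-copy-edge⁻ : ∀ {h} a {u v : Vertex h} → GridEdge (in-copy a u) (in-copy a v) → GridEdge u v
  in-copy-edge⁻ a (inj₁ (i≡j , e)) = inj₁ (i≡j , copy-edge⁻ a e)
  in-copy-edge⁻ a (inj₂ (refl , e)) = inj₂ (refl , e)

  in-copy-far : ∀ {h} a {u v : Vertex h} → Far u v → Far (in-copy a u) (in-copy a v)
  in-copy-far a (u≢v , ¬uv) = (λ e → u≢v (in-copy-injective a e)) , (λ e → ¬uv (in-copy-edge⁻ a e))

  lift-matching : ∀ {h} a (pos : Vertex (suc h) → ℕ) {t l} →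
                  CrossingMatching (λ v → pos (in-copy a v)) t l → CrossingMatching pos t l
  lift-matching a pos M = record
    { edge = λ i → in-copy a (proj₁ (edge i)) , in-copy a (proj₂ (edge i))
    ; crosses = λ i → let (e , before , after) = crosses i in in-copy-edge a e , before , after
    ; separated = λ i j i≢j → let (f₁ , f₂ , f₃ , f₄) = separated i j i≢j in
        in-copy-far a f₁ , in-copy-far a f₂ , in-copy-far a f₃ , in-copy-far a f₄ }
    where open CrossingMatching M

  avoids-far : ∀ {h} b {u : Node (suc h)} {y : Node h} i j → Avoids b u → Far (u , i) (copy b y , j)
  avoids-far b {u} {y} i j avoids = far-columns i j (avoids⇒≢copy b u y avoids) (avoids⇒¬edge-copy b u y avoids)

  module CopyLevel (h m : ℕ) (IH : Claim h m) (pos : Vertex (suc h) → ℕ) (pos-inj : Injective _≡_ _≡_ pos) where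

    pos-in : Fin 3 → Vertex h → ℕ
    pos-in a v = pos (in-copy a v)

    module Ordered (straddle : ∀ a → Straddles h m (pos-in a)) {a b c : Fin 3} (a≢b : a ≢ b) (c≢b : c ≢ b)
                   (a≤b : Straddles.threshold (straddle a) ≤ Straddles.threshold (straddle b))
                   (b≤c : Straddles.threshold (straddle b) ≤ Straddles.threshold (straddle c)) where
      open Straddles

      T : ℕ
      T = threshold (straddle b)

      a-before : BeforeAt pos T (copy a (early (straddle a)))
      a-before j = ≤-trans (early-before (straddle a) j) a≤b

      c-after : AfterAt pos T (copy c (late (straddle c)))
      c-after j = ≤-trans b≤c (late-after (straddle c) j)

      crossing-in-layer : ∀ r → ∃₂ λ u v → TreeEdge u v × Avoids b u × Avoids b v ×
                          pos (u , spaced-layer r) < T × T ≤ pos (v , spaced-layer r)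
      crossing-in-layer r
        with leaving-edge (λ x → pos (x , spaced-layer r) < T) (λ x → pos (x , spaced-layer r) <? T)
               (walk-between-copies a≢b c≢b (early (straddle a)) (late (straddle c)))
               (a-before (spaced-layer r)) (≤⇒≯ (c-after (spaced-layer r)))
      ... | u , v , e , avoids-u , avoids-v , before , ¬before = u , v , e , avoids-u , avoids-v , before , ≮⇒≥ ¬before

      new-edge : Fin R → Edge (suc h)
      new-edge r = (proj₁ (crossing-in-layer r) , spaced-layer r) ,
                   (proj₁ (proj₂ (crossing-in-layer r)) , spaced-layer r)

      new-matching : CrossingMatching pos T R
      new-matching = record
        { edge = new-edge
        ; crosses = λ r → let (_ , _ , e , _ , _ , before , after) = crossing-in-layer r in
            inj₁ (refl , e) , before , after
        ; separated = λ r r′ r≢r′ → far r≢r′ , far r≢r′ , far r≢r′ , far r≢r′ }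
        where
          far : ∀ {r r′} → r ≢ r′ → ∀ {x y} → Far (x , spaced-layer r) (y , spaced-layer r′)
          far r≢r′ = spaced-layers-far r≢r′ _ _

      old-matching : CrossingMatching pos T (size (straddle b))
      old-matching = lift-matching b pos (matching (straddle b))

      old-new-separated : ∀ i r → Separated (CrossingMatching.edge old-matching i) (new-edge r)
      old-new-separated i r = let (_ , _ , _ , avoids-u , avoids-v , _) = crossing-in-layer r in
        Far-sym (avoids-far b _ _ avoids-u) , Far-sym (avoids-far b _ _ avoids-v) ,
        Far-sym (avoids-far b _ _ avoids-u) , Far-sym (avoids-far b _ _ avoids-v)

      straddles : Straddles (suc h) (m + R) pos
      straddles = record
        { threshold = T
        ; size = size (straddle b) + R
        ; m≤size = +-monoˡ-≤ R (m≤size (straddle b))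
        ; matching = append-matching old-matching new-matching old-new-separated
        ; early = copy a (early (straddle a)) ; early-before = a-before
        ; late = copy c (late (straddle c)) ; late-after = c-after }

    all-straddle : (∀ a → Straddles h m (pos-in a)) → Straddles (suc h) (m + R) pos
    all-straddle straddle with median (λ a → Straddles.threshold (straddle a))
    ... | b , a , c , a≢b , c≢b , a≤b , b≤c = Ordered.straddles straddle a≢b c≢b a≤b b≤c

    outcome : Outcome (suc h) (m + R) pos
    outcome with outcome-in zero | outcome-in (suc zero) | outcome-in (suc (suc zero))
      where
        outcome-in : ∀ a → Outcome h m (pos-in a)
        outcome-in a = IH (pos-in a) (λ e → in-copy-injective a (pos-inj e))
    ... | inj₁ (t , l , B≤l , M) | _ | _ = inj₁ (t , l , B≤l , lift-matching zero pos M)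
    ... | inj₂ _ | inj₁ (t , l , B≤l , M) | _ = inj₁ (t , l , B≤l , lift-matching (suc zero) pos M)
    ... | inj₂ _ | inj₂ _ | inj₁ (t , l , B≤l , M) = inj₁ (t , l , B≤l , lift-matching (suc (suc zero)) pos M)
    ... | inj₂ s₀ | inj₂ s₁ | inj₂ s₂ =
      inj₂ (all-straddle λ { zero → s₀ ; (suc zero) → s₁ ; (suc (suc zero)) → s₂ })

  claim : ∀ h → Claim h (h * R)
  claim zero = claim-path
  claim (suc h) pos pos-inj = subst (λ m → Outcome (suc h) m pos) (+-comm (h * R) R)
    (CopyLevel.outcome h (h * R) (claim h) pos pos-inj)

-- Treewidth and linear induced matching width of the graphs

module FromRelation {A : Set} {m : ℕ} (A↔Fin : A ↔ Fin m) (_~_ : A → A → Set) (_~?_ : ∀ x y → Dec (x ~ y))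
                    (~-sym : ∀ {x y} → x ~ y → y ~ x) (~-irrefl : ∀ x → ¬ x ~ x) where

  open Inverse A↔Fin public using (to; from; strictlyInverseˡ; strictlyInverseʳ)

  graph : Graph
  graph = record
    { n = m
    ; E = λ i j → does (from i ~? from j)
    ; sym = λ i j → does-⇔ (mk⇔ ~-sym ~-sym) (from i ~? from j) (from j ~? from i)
    ; irrefl = λ i → dec-false (from i ~? from i) (~-irrefl (from i)) }

  Adj⇒edge : ∀ {i j} → Adj graph i j → from i ~ from j
  Adj⇒edge {i} {j} e = invert (subst (Reflects _) e (proof (from i ~? from j)))

  edge⇒Adj : ∀ {x y} → x ~ y → Adj graph (to x) (to y)
  edge⇒Adj {x} {y} e = dec-true (from (to x) ~? from (to y))
    (subst₂ _~_ (sym (strictlyInverseʳ x)) (sym (strictlyInverseʳ y)) e)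

  to-injective : ∀ {x y} → to x ≡ to y → x ≡ y
  to-injective {x} {y} e = trans (sym (strictlyInverseʳ x)) (trans (cong from e) (strictlyInverseʳ y))

  walk⇒WalkIn : ∀ {Q : A → Set} {P : Fin m → Set} → (∀ {x} → Q x → P (to x)) →
                ∀ {x y} → Walk _~_ Q x y → WalkIn graph P (to x) (to y)
  walk⇒WalkIn Q⇒P (here q) = here (Q⇒P q)
  walk⇒WalkIn Q⇒P (step q e w) = step (Q⇒P q) (edge⇒Adj e) (walk⇒WalkIn Q⇒P w)

  walk⇒WalkIn′ : ∀ {Q : A → Set} {P : Fin m → Set} → (∀ {x} → Q x → P (to x)) →
                 ∀ {i j} → Walk _~_ Q (from i) (from j) → WalkIn graph P i j
  walk⇒WalkIn′ {P = P} Q⇒P {i} {j} w =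
    subst₂ (WalkIn graph P) (strictlyInverseˡ i) (strictlyInverseˡ j) (walk⇒WalkIn Q⇒P w)

  from-injective : ∀ {i j} → from i ≡ from j → i ≡ j
  from-injective {i} {j} e = trans (sym (strictlyInverseˡ i)) (trans (cong to e) (strictlyInverseˡ j))

  Adj-to⇒edge : ∀ {x y} → Adj graph (to x) (to y) → x ~ y
  Adj-to⇒edge {x} {y} e = subst₂ _~_ (strictlyInverseʳ x) (strictlyInverseʳ y) (Adj⇒edge e)

module Witness (B R′ h : ℕ) where

  open Grid B R′ public

  module TreeGraph = FromRelation (node↔fin h) TreeEdge TreeEdge? TreeEdge-sym TreeEdge-irrefl
  open TreeGraph using () renaming (graph to tree)

  tree-connected : Connected tree
  tree-connected i j = TreeGraph.walk⇒WalkIn′ (λ _ → tt)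
    (walk-to-root h (TreeGraph.from i) ++ʷ reverseʷ TreeEdge-sym (walk-to-root h (TreeGraph.from j)))

  -- Both cycle neighbours of the deepest node of a cycle would have to be its parent.
  tree-acyclic : ¬ Cycle tree
  tree-acyclic cycle = two-parents (cycle-neighbours m len≥3 (λ i j → Adj tree (f i) (f j)) path close deepest)
    where
      open Cycle cycle
      node : Fin (suc m) → Node h
      node i = TreeGraph.from (f i)
      deepest : Fin (suc m)
      deepest = proj₁ (argmax λ i → depth (node i))
      Neighbour : Fin (suc m) → Set
      Neighbour j = Adj tree (f deepest) (f j) ⊎ Adj tree (f j) (f deepest)
      neighbour-edge : ∀ {j} → Neighbour j → TreeEdge (node deepest) (node j)
      neighbour-edge (inj₁ e) = TreeGraph.Adj⇒edge e
      neighbour-edge (inj₂ e) = TreeEdge-sym (TreeGraph.Adj⇒edge e)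
      neighbour-is-parent : ∀ {j} → Neighbour j → parent (node deepest) ≡ just (node j)
      neighbour-is-parent {j} nb with neighbour-edge nb
      ... | inj₂ e = e
      ... | inj₁ e = ⊥-elim (<⇒≱ (≤-reflexive (sym (depth-parent (node j) e))) (proj₂ (argmax λ i → depth (node i)) j))
      two-parents : ¬ ∃₂ λ j k → j ≢ k × Neighbour j × Neighbour k
      two-parents (j , k , j≢k , j∼ , k∼) =
        j≢k (inj (TreeGraph.from-injective
          (just-injective (trans (sym (neighbour-is-parent j∼)) (neighbour-is-parent k∼)))))

  vertex↔fin : Vertex h ↔ Fin (node-count h * L)
  vertex↔fin = ↔-trans (node↔fin h ×-↔ ↔-refl) (↔-sym *↔×)

  GridEdge? : (u v : Vertex h) → Dec (GridEdge u v)
  GridEdge? (x , i) (y , j) = ((i Fin.≟ j) ×-dec TreeEdge? x y) ⊎-dec ((x ≟ y) ×-dec LayerEdge? i j)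
    where
      LayerEdge? : ∀ i j → Dec (LayerEdge i j)
      LayerEdge? i j = (toℕ j Data.Nat.≟ suc (toℕ i)) ⊎-dec (toℕ i Data.Nat.≟ suc (toℕ j))

  GridEdge-irrefl : (u : Vertex h) → ¬ GridEdge u u
  GridEdge-irrefl (x , _) (inj₁ (_ , e)) = TreeEdge-irrefl x e
  GridEdge-irrefl (x , _) (inj₂ (_ , inj₁ e)) = 1+n≢n (sym e)
  GridEdge-irrefl (x , _) (inj₂ (_ , inj₂ e)) = 1+n≢n (sym e)

  module GridGraph = FromRelation vertex↔fin GridEdge GridEdge? GridEdge-sym GridEdge-irrefl
  open GridGraph public using () renaming (graph to grid)

  InBag : Node h → Node h → Set
  InBag c x = x ≡ c ⊎ parent c ≡ just x

  InBag? : ∀ c x → Dec (InBag c x)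
  InBag? c x = (x ≟ c) ⊎-dec ≡-dec-Maybe _≟_ (parent c) (just x)

  column : Fin (node-count h * L) → Node h
  column v = proj₁ (GridGraph.from v)

  bag : Fin (node-count h) → Subset (node-count h * L)
  bag t = subset λ v → InBag? (TreeGraph.from t) (column v)

  in-bag : ∀ c v → InBag c (column v) → v ∈ bag (TreeGraph.to c)
  in-bag c v p = ∈-subset⁺ (λ v → InBag? (TreeGraph.from (TreeGraph.to c)) (column v))
    (subst (λ z → InBag z (column v)) (sym (TreeGraph.strictlyInverseʳ c)) p)

  bag-member : ∀ t v → v ∈ bag t → InBag (TreeGraph.from t) (column v)
  bag-member t v = ∈-subset⁻ (λ v → InBag? (TreeGraph.from t) (column v))

  bag-walk : ∀ x {c c′} → InBag c x → InBag c′ x → Walk TreeEdge (λ z → InBag z x) c c′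
  bag-walk x (inj₁ refl) (inj₁ refl) = here (inj₁ refl)
  bag-walk x (inj₁ refl) (inj₂ p′) = step (inj₁ refl) (inj₁ p′) (here (inj₂ p′))
  bag-walk x (inj₂ p) (inj₁ refl) = step (inj₂ p) (inj₂ p) (here (inj₁ refl))
  bag-walk x (inj₂ p) (inj₂ p′) = step (inj₂ p) (inj₂ p) (step (inj₁ refl) (inj₁ p′) (here (inj₂ p′)))

  bag-size : ∀ t → ∣ bag t ∣ ≤ 2 * L
  bag-size t = ∣p∣≤-by-injection (bag t) (λ v _ → code v) code-injective
    where
      c : Node h
      c = TreeGraph.from t
      side : Fin (node-count h * L) → Fin 2
      side v with column v ≟ c
      ... | yes _ = zero
      ... | no _ = suc zero
      same-column : ∀ v w → InBag c (column v) → InBag c (column w) → side v ≡ side w → column v ≡ column w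
      same-column v w v∈ w∈ e with column v ≟ c | column w ≟ c
      ... | yes v≡c | yes w≡c = trans v≡c (sym w≡c)
      ... | no v≢c | no w≢c with v∈ | w∈
      ...   | inj₁ v≡c | _ = ⊥-elim (v≢c v≡c)
      ...   | _ | inj₁ w≡c = ⊥-elim (w≢c w≡c)
      ...   | inj₂ pv | inj₂ pw = just-injective (trans (sym pv) pw)
      same-column v w v∈ w∈ () | yes _ | no _
      same-column v w v∈ w∈ () | no _ | yes _
      -- A vertex of the bag is determined by its layer and by whether its column is c.
      code : Fin (node-count h * L) → Fin (2 * L)
      code v = combine (side v) (proj₂ (GridGraph.from v))
      code-injective : ∀ v w (v∈ : v ∈ bag t) (w∈ : w ∈ bag t) → code v ≡ code w → v ≡ w
      code-injective v w v∈ w∈ e with combine-injective (side v) _ (side w) _ e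
      ... | same-side , same-layer = GridGraph.from-injective
        (cong₂ _,_ (same-column v w (bag-member t v v∈) (bag-member t w w∈) same-side) same-layer)

  decomposition : ∀ k → 2 * L ≤ suc k → TwAtMost grid k
  decomposition k 2L≤1+k = record
    { T = tree
    ; isTree = 1≤node-count h , tree-connected , tree-acyclic
    ; bag = bag
    ; coverV = λ v → TreeGraph.to (column v) , in-bag (column v) v (inj₁ refl)
    ; coverE = cover-edge
    ; subtree = λ v t t′ v∈t v∈t′ → TreeGraph.walk⇒WalkIn′ (λ {c} → in-bag c v)
        (bag-walk (column v) (bag-member t v v∈t) (bag-member t′ v v∈t′))
    ; width≤k = λ t → ≤-trans (bag-size t) 2L≤1+k }
    where
      1≤node-count : ∀ h → 1 ≤ node-count h
      1≤node-count zero = s≤s z≤n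
      1≤node-count (suc h) = s≤s z≤n
      cover-edge : ∀ u v → Adj grid u v → ∃ λ t → u ∈ bag t × v ∈ bag t
      cover-edge u v uv with GridGraph.Adj⇒edge uv
      ... | inj₁ (_ , inj₁ p) = TreeGraph.to (column v) , in-bag (column v) u (inj₂ p) , in-bag (column v) v (inj₁ refl)
      ... | inj₁ (_ , inj₂ p) = TreeGraph.to (column u) , in-bag (column u) u (inj₁ refl) , in-bag (column u) v (inj₂ p)
      ... | inj₂ (x≡y , _) =
        TreeGraph.to (column u) , in-bag (column u) u (inj₁ refl) , in-bag (column u) v (inj₁ (sym x≡y))

  far⇒apart : ∀ {u v} → Far u v → GridGraph.to u ≢ GridGraph.to v × ¬ Adj grid (GridGraph.to u) (GridGraph.to v)
  far⇒apart (u≢v , ¬uv) = (λ e → u≢v (GridGraph.to-injective e)) , (λ e → ¬uv (GridGraph.Adj-to⇒edge e))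

  induced-matching : ∀ {pos : Vertex h → ℕ} {t l} → CrossingMatching pos t l → InducedMatching grid l
  induced-matching {l = l} M = record
    { ends = ends
    ; isEdge = λ i → GridGraph.edge⇒Adj (proj₁ (crosses i))
    ; disjoint = λ i j i≢j x y x∈ y∈ → proj₁ (apart i j i≢j x∈ y∈)
    ; induced = λ i j i≢j x y x∈ y∈ → proj₂ (apart i j i≢j x∈ y∈) }
    where
      open CrossingMatching M
      ends : Fin l → Fin (node-count h * L) × Fin (node-count h * L)
      ends i = GridGraph.to (proj₁ (edge i)) , GridGraph.to (proj₂ (edge i))
      Endpoint : Fin l → Fin (node-count h * L) → Set
      Endpoint i x = x ≡ proj₁ (ends i) ⊎ x ≡ proj₂ (ends i)
      apart : ∀ i j → i ≢ j → ∀ {x y} → Endpoint i x → Endpoint j y → x ≢ y × ¬ Adj grid x y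
      apart i j i≢j x∈ y∈ with separated i j i≢j
      apart i j i≢j (inj₁ refl) (inj₁ refl) | far , _ , _ , _ = far⇒apart far
      apart i j i≢j (inj₁ refl) (inj₂ refl) | _ , far , _ , _ = far⇒apart far
      apart i j i≢j (inj₂ refl) (inj₁ refl) | _ , _ , far , _ = far⇒apart far
      apart i j i≢j (inj₂ refl) (inj₂ refl) | _ , _ , _ , far = far⇒apart far

  position : LinearOrder grid → Vertex h → ℕ
  position σ v = toℕ (σ ⟨$⟩ʳ GridGraph.to v)

  position-injective : ∀ σ → Injective _≡_ _≡_ (position σ)
  position-injective σ e =
    GridGraph.to-injective (trans (sym (inverseˡ σ)) (trans (cong (σ ⟨$⟩ˡ_) (toℕ-injective e)) (inverseˡ σ)))

  induced-matching-crosses : ∀ σ {t l} (M : CrossingMatching (position σ) t l) → Crosses grid (induced-matching M) σ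
  induced-matching-crosses σ {t} M = t , λ i → inj₁ (proj₁ (proj₂ (crosses i)) , ≤⇒≯ (proj₂ (proj₂ (crosses i))))
    where open CrossingMatching M

  lsimw≥ : ∀ s → s ≤ B → s ≤ h * R → LsimwAtLeast grid s
  lsimw≥ s s≤B s≤hR σ with claim h (position σ) (position-injective σ)
  ... | inj₁ (t , l , B≤l , M) = l , ≤-trans s≤B B≤l , induced-matching M , induced-matching-crosses σ M
  ... | inj₂ st = size , ≤-trans s≤hR m≤size , induced-matching matching , induced-matching-crosses σ matching
    where open Straddles st

-- Counting vertices

n≤2^n : ∀ n → n ≤ 2 ^ n
n≤2^n zero = z≤n
n≤2^n (suc n) =
  ≤-trans (s≤s (≤-trans (n≤2^n n) (≤-reflexive (sym (+-identityʳ (2 ^ n)))))) (+-monoˡ-≤ (2 ^ n + 0) (m^n>0 2 n))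

grid-size-bound : ∀ h R → 1 ≤ R → R ≤ h → 3 ^ h * (2 * (h * R) + 3) * (2 * R) ≤ 2 ^ (9 * h)
grid-size-bound h R 1≤R R≤h = begin
  3 ^ h * (2 * (h * R) + 3) * (2 * R)                  ≤⟨ *-mono-≤ (*-mono-≤ powers-of-3 base-path) layers ⟩
  2 ^ (h + h) * 2 ^ (3 + (h + h)) * 2 ^ (1 + h)        ≡⟨ cong (_* 2 ^ (1 + h)) (^-distribˡ-+-* 2 (h + h) (3 + (h + h))) ⟨
  2 ^ ((h + h) + (3 + (h + h))) * 2 ^ (1 + h)          ≡⟨ ^-distribˡ-+-* 2 ((h + h) + (3 + (h + h))) (1 + h) ⟨
  2 ^ ((h + h) + (3 + (h + h)) + (1 + h))              ≤⟨ ^-monoʳ-≤ 2 exponent ⟩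
  2 ^ (9 * h)                                          ∎
  where
    open ≤-Reasoning
    1≤h : 1 ≤ h
    1≤h = ≤-trans 1≤R R≤h
    h≤2^h : h ≤ 2 ^ h
    h≤2^h = n≤2^n h
    powers-of-3 : 3 ^ h ≤ 2 ^ (h + h)
    powers-of-3 = begin
      3 ^ h        ≤⟨ ^-monoˡ-≤ h (s≤s (s≤s (s≤s z≤n))) ⟩
      (2 ^ 2) ^ h  ≡⟨ ^-*-assoc 2 2 h ⟩
      2 ^ (2 * h)  ≡⟨ cong (2 ^_) (cong (h +_) (+-identityʳ h)) ⟩
      2 ^ (h + h)  ∎
    base-path : 2 * (h * R) + 3 ≤ 2 ^ (3 + (h + h))
    base-path = begin
      2 * (h * R) + 3              ≤⟨ +-monoʳ-≤ (2 * (h * R)) (*-monoʳ-≤ 3 (*-mono-≤ 1≤h 1≤R)) ⟩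
      2 * (h * R) + 3 * (h * R)    ≡⟨ *-distribʳ-+ (h * R) 2 3 ⟨
      5 * (h * R)                  ≤⟨ *-mono-≤ {5} {8} (s≤s (s≤s (s≤s (s≤s (s≤s z≤n)))))
                                                       (*-mono-≤ h≤2^h (≤-trans R≤h h≤2^h)) ⟩
      8 * (2 ^ h * 2 ^ h)          ≡⟨ cong (8 *_) (^-distribˡ-+-* 2 h h) ⟨
      8 * 2 ^ (h + h)              ≡⟨ ^-distribˡ-+-* 2 3 (h + h) ⟨
      2 ^ (3 + (h + h))            ∎
    layers : 2 * R ≤ 2 ^ (1 + h)
    layers = *-monoʳ-≤ 2 (≤-trans R≤h h≤2^h)
    exponent : (h + h) + (3 + (h + h)) + (1 + h) ≤ 9 * h
    exponent = begin
      (h + h) + (3 + (h + h)) + (1 + h)   ≡⟨ collect h ⟩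
      5 * h + 4                           ≤⟨ +-monoʳ-≤ (5 * h) (*-monoʳ-≤ 4 1≤h) ⟩
      5 * h + 4 * h                       ≡⟨ *-distribʳ-+ h 5 4 ⟨
      9 * h                               ∎
      where
        collect : ∀ h → (h + h) + (3 + (h + h)) + (1 + h) ≡ 5 * h + 4
        collect = solve-∀

power-bound : ∀ {X} h R k → X ≤ 2 ^ (9 * h) → k ≤ 8 * R → X ^ (1 * k) ≤ 2 ^ (72 * (h * R))
power-bound {X} h R k X≤ k≤8R = begin
  X ^ (1 * k)                ≤⟨ ^-monoˡ-≤ (1 * k) X≤ ⟩
  (2 ^ (9 * h)) ^ (1 * k)    ≡⟨ ^-*-assoc 2 (9 * h) (1 * k) ⟩
  2 ^ (9 * h * (1 * k))      ≤⟨ ^-monoʳ-≤ 2 (*-monoʳ-≤ (9 * h) (≤-trans (≤-reflexive (*-identityˡ k)) k≤8R)) ⟩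
  2 ^ (9 * h * (8 * R))      ≡⟨ cong (2 ^_) (regroup h R) ⟩
  2 ^ (72 * (h * R))         ∎
  where
    open ≤-Reasoning
    regroup : ∀ h R → 9 * h * (8 * R) ≡ 72 * (h * R)
    regroup = solve-∀

quarter : ∀ k → 4 ≤ k → ∃ λ R′ → 4 * suc R′ ≤ k × k ≤ 8 * suc R′
quarter k 4≤k with k / 4 in k/4≡ | m≥n⇒m/n>0 {k} {4} 4≤k
... | suc R′ | _ = R′ , lower , upper
  where
    lower : 4 * suc R′ ≤ k
    lower = subst (λ q → 4 * q ≤ k) k/4≡ (≤-trans (≤-reflexive (*-comm 4 (k / 4))) (m/n*n≤m k 4))
    upper : k ≤ 8 * suc R′
    upper = begin
      k                          ≡⟨ m≡m%n+[m/n]*n k 4 ⟩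
      k % 4 + k / 4 * 4          ≤⟨ +-mono-≤ (<⇒≤ (m%n<n k 4)) (≤-reflexive (cong (_* 4) k/4≡)) ⟩
      4 + suc R′ * 4             ≤⟨ +-monoˡ-≤ (suc R′ * 4) (*-monoʳ-≤ 4 (s≤s z≤n)) ⟩
      4 * suc R′ + suc R′ * 4    ≡⟨ double (suc R′) ⟩
      8 * suc R′                 ∎
      where
        open ≤-Reasoning
        double : ∀ r → 4 * r + r * 4 ≡ 8 * r
        double = solve-∀

lemma1 : Σ ℕ λ p → Σ ℕ λ q → (1 ≤ p) × (1 ≤ q) × Σ ℕ λ K →
    ∀ k → K ≤ k → ∀ N → Σ Graph λ G →
      (N ≤ ∣V∣ G) × TwAtMost G k ×
      Σ ℕ λ s → LsimwAtLeast G s × (∣V∣ G ^ (p * k) ≤ 2 ^ (q * s))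
lemma1 = 1 , 72 , s≤s z≤n , s≤s z≤n , 4 , witness
  where
    witness : ∀ k → 4 ≤ k → ∀ N → Σ Graph λ G → (N ≤ ∣V∣ G) × TwAtMost G k ×
              Σ ℕ λ s → LsimwAtLeast G s × (∣V∣ G ^ (1 * k) ≤ 2 ^ (72 * s))
    witness k 4≤k N with quarter k 4≤k
    ... | R′ , 4R≤k , k≤8R = grid , N≤∣V∣ , decomposition k 2L≤1+k , h * R , lsimw≥ (h * R) ≤-refl ≤-refl ,
                             power-bound h R k (≤-trans ∣V∣≤ (grid-size-bound h R (s≤s z≤n) R≤h)) k≤8R
      where
        h : ℕ
        h = N + k
        open Witness (h * suc R′) R′ h
        R≤h : R ≤ h
        R≤h = ≤-trans (m≤n*m R 4) (≤-trans 4R≤k (m≤n+m k N))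
        2L≤1+k : 2 * L ≤ suc k
        2L≤1+k = ≤-trans (≤-reflexive (sym (*-assoc 2 2 R))) (≤-trans 4R≤k (n≤1+n k))
        N≤∣V∣ : N ≤ node-count h * L
        N≤∣V∣ = ≤-trans (m≤m+n N k) (≤-trans (m≤m*n h R) (≤-trans (m≤n*m (h * R) 2)
                  (≤-trans (<⇒≤ (path-length<node-count h)) (m≤m*n (node-count h) L))))
        ∣V∣≤ : node-count h * L ≤ 3 ^ h * (2 * (h * R) + 3) * (2 * R)
        ∣V∣≤ = *-monoˡ-≤ L (≤-trans (m≤m+n (node-count h) 2) (≤-reflexive (node-count-closed h)))
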